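{- Let $G$ and $M$ be finite groups of the same order, and let $\alpha:M\to\mathrm{Perm}(G)$ be an embedding whose image $\alpha(M)$ is a $G$-stable regular subgroup. Let $a:M\to G$ be $a(\mu)=\alpha(\mu)[e_G]$ and $\beta:G\to\mathrm{Perm}(M)$ be $\beta(h)=a^{ -1}\lambda_G(h)a$ (so $\beta(G)\subseteq\mathrm{Hol}(M)$). For $g\in G$, let $\alpha_g:M\to\mathrm{Perm}(G)$ be $\alpha_g(\mu)=\varphi_g\alpha(\mu)\varphi_g^{ -1}$, and let $\beta_g$ be the embedding of $G$ into $\mathrm{Perm}(M)$ obtained from $\alpha_g$ by the same construction (i.e. $a_g(\mu)=\alpha_g(\mu)[e_G]$, $\beta_g(h)=a_g^{ -1}\lambda_G(h)a_g$). Then $\beta_g=\beta\circ\varphi_{g^{ -1}}$.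
   Context: $\mathrm{Perm}(X)$ is the group of permutations of a set $X$; $\lambda_G(g)[h]=gh$ and $\rho_G(g)[h]=hg^{ -1}$ are the left and right regular representations of $G$, and $\varphi_g(h)=ghg^{ -1}$ is the inner automorphism (as a permutation of $G$, $\varphi_g=\rho_G(g)\lambda_G(g)$). A subgroup of $\mathrm{Perm}(G)$ is regular if it acts simply transitively on $G$, and $G$-stable if normalized by $\lambda_G(G)$. $\mathrm{Hol}(M)=\lambda_M(M)\mathrm{Aut}(M)\subseteq\mathrm{Perm}(M)$ is the holomorph. ($\alpha_g$ is again an embedding with $G$-stable regular image $\rho_G(g)\alpha(M)\rho_G(g)^{ -1}$.) -}

module Defs where

open import Level using (0ℓ)
open import Data.Nat using (ℕ)
open import Data.Fin using (Fin)
open import Data.Product using (Σ; _,_; proj₁; proj₂)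
open import Function using (_∘_)
open import Function.Bundles using (_↔_; Inverse)
open import Algebra.Structures using (IsGroup)
open import Algebra.Bundles using (Group)
import Algebra.Properties.Group as GP
open import Relation.Binary.PropositionalEquality
  using (_≡_; refl; sym; trans; cong; cong₂; module ≡-Reasoning)

record FinGroup (n : ℕ) : Set₁ where
  infixl 7 _∙_
  field
    Carrier  : Set
    _∙_      : Carrier → Carrier → Carrier
    e        : Carrier
    _⁻¹      : Carrier → Carrier
    isGroup  : IsGroup _≡_ _∙_ e _⁻¹
    finite   : Carrier ↔ Fin n

  group : Group 0ℓ 0ℓ
  group = record { isGroup = isGroup }

Perm : Set → Set
Perm X = X ↔ X

_[_] : ∀ {X : Set} → Perm X → X → X
σ [ x ] = Inverse.to σ x

_≈P_ : ∀ {X : Set} → Perm X → Perm X → Set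
σ ≈P τ = ∀ x → σ [ x ] ≡ τ [ x ]

module _ {n m : ℕ} (M : FinGroup m) (G : FinGroup n) where
  private
    module M = FinGroup M
    module G = FinGroup G

  IsHom : (M.Carrier → Perm G.Carrier) → Set
  IsHom α = ∀ μ ν x → α (μ M.∙ ν) [ x ] ≡ α μ [ α ν [ x ] ]

  IsInjective : (M.Carrier → Perm G.Carrier) → Set
  IsInjective α = ∀ μ ν → α μ ≈P α ν → μ ≡ ν

-- regular subgroup: the image acts simply transitively on G
record IsRegular {n m : ℕ} (M : FinGroup m) (G : FinGroup n)
                 (act : FinGroup.Carrier M → FinGroup.Carrier G → FinGroup.Carrier G) : Set where
  field
    transitive : ∀ x y → Σ (FinGroup.Carrier M) (λ μ → act μ x ≡ y)
    free       : ∀ μ ν x → act μ x ≡ act ν x → ∀ z → act μ z ≡ act ν z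

module _ {n : ℕ} (G : FinGroup n) where
  open FinGroup G
  λG : Carrier → Carrier → Carrier
  λG g h = g ∙ h
  φ : Carrier → Carrier → Carrier
  φ g h = g ∙ h ∙ g ⁻¹

  φ-inv : ∀ g y → φ g (φ (g ⁻¹) y) ≡ y
  φ-inv g y = begin
      g ∙ (g ⁻¹ ∙ y ∙ g ⁻¹ ⁻¹) ∙ g ⁻¹
        ≡⟨ cong (λ t → g ∙ (g ⁻¹ ∙ y ∙ t) ∙ g ⁻¹) (GP.⁻¹-involutive group g) ⟩
      g ∙ (g ⁻¹ ∙ y ∙ g) ∙ g ⁻¹
        ≡⟨ cong (_∙ g ⁻¹) (sym (assoc g (g ⁻¹ ∙ y) g)) ⟩
      g ∙ (g ⁻¹ ∙ y) ∙ g ∙ g ⁻¹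
        ≡⟨ assoc (g ∙ (g ⁻¹ ∙ y)) g (g ⁻¹) ⟩
      g ∙ (g ⁻¹ ∙ y) ∙ (g ∙ g ⁻¹)
        ≡⟨ cong₂ _∙_ (sym (assoc g (g ⁻¹) y)) (inverseʳ g) ⟩
      g ∙ g ⁻¹ ∙ y ∙ e
        ≡⟨ identityʳ _ ⟩
      g ∙ g ⁻¹ ∙ y
        ≡⟨ cong (_∙ y) (inverseʳ g) ⟩
      e ∙ y
        ≡⟨ identityˡ y ⟩
      y ∎
    where
      open ≡-Reasoning
      open IsGroup isGroup using (assoc; identityˡ; identityʳ; inverseˡ; inverseʳ)

module _ {n : ℕ} (M : FinGroup n) (G : FinGroup n) where
  private
    module M = FinGroup M
    module G = FinGroup G

  -- G-stable: the image α(M) is normalised by λ_G(G), i.e. for all g, μ,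
  -- λ_G(g) α(μ) λ_G(g)⁻¹ = α(ν) for some ν  (λ_G(g)⁻¹ = λ_G(g⁻¹))
  IsGStable : (M.Carrier → Perm G.Carrier) → Set
  IsGStable α = ∀ g μ → Σ M.Carrier
    (λ ν → ∀ x → λG G g (α μ [ λG G (g G.⁻¹) x ]) ≡ α ν [ x ])

  -- Construction of β from a regular action act (a(μ) = act μ e_G,
  -- a⁻¹ obtained from transitivity, which is a bijection by regularity):
  -- β(h)[μ] = a⁻¹ (λ_G(h) (a μ))
  βOf : (act : M.Carrier → G.Carrier → G.Carrier) → IsRegular M G act →
        G.Carrier → M.Carrier → M.Carrier
  βOf act reg h μ = proj₁ (IsRegular.transitive reg G.e (λG G h (act μ G.e)))

  -- α_g(μ) = φ_g α(μ) φ_g⁻¹, as an action on G (φ_g⁻¹ = φ_{g⁻¹})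
  actG : (M.Carrier → Perm G.Carrier) → G.Carrier →
         M.Carrier → G.Carrier → G.Carrier
  actG α g μ x = φ G g (α μ [ φ G (g G.⁻¹) x ])

  regG : (α : M.Carrier → Perm G.Carrier) → IsRegular M G (λ μ → α μ [_]) →
         (g : G.Carrier) → IsRegular M G (actG α g)
  regG α reg g = record
    { transitive = λ x y →
        let (μ , p) = IsRegular.transitive reg (φ G (g G.⁻¹) x) (φ G (g G.⁻¹) y)
        in μ , trans (cong (φ G g) p) (φ-inv G g y)
    ; free = λ μ ν x p z →
        cong (φ G g) (IsRegular.free reg μ ν (φ G (g G.⁻¹) x)
               (φ-cancel (α μ [ φ G (g G.⁻¹) x ]) (α ν [ φ G (g G.⁻¹) x ]) p)
               (φ G (g G.⁻¹) z))
    }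
    where
      φ-cancel : ∀ a b → φ G g a ≡ φ G g b → a ≡ b
      φ-cancel a b p = trans (sym (φ-inv' a)) (trans (cong (φ G (g G.⁻¹)) p) (φ-inv' b))
        where
          φ-inv' : ∀ y → φ G (g G.⁻¹) (φ G g y) ≡ y
          φ-inv' y = trans (cong (λ t → φ G (g G.⁻¹) (φ G t y))
                              (sym (GP.⁻¹-involutive (FinGroup.group G) g)))
                           (φ-inv G (g G.⁻¹) y)

  βgOf : (α : M.Carrier → Perm G.Carrier) → IsRegular M G (λ μ → α μ [_]) →
         G.Carrier → G.Carrier → M.Carrier → M.Carrier
  βgOf α reg g = βOf (actG α g) (regG α reg g)

{-# OPTIONS --safe #-}
module Submission where

-- Write x₀ = α(μ)[e].  The element β(h)[μ] is characterised by α(β(h)[μ])[e] = h x₀,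
-- because the action of α(M) is regular and α is injective.  Since φ_g fixes e, the
-- twisted action gives α_g(ν)[e] = φ_g(α(ν)[e]); applying the automorphism φ_{g⁻¹} to
-- the defining equation of β_g(h)[μ] turns it into α(β_g(h)[μ])[e] = φ_{g⁻¹}(h) x₀,
-- the defining equation of β(φ_{g⁻¹}(h))[μ].

open import Defs
open import Data.Nat using (ℕ)
open import Data.Product using (proj₂)
open import Algebra.Structures using (IsGroup)
import Algebra.Properties.Group as GroupProperties
open import Relation.Binary.PropositionalEquality
  using (_≡_; sym; trans; cong; module ≡-Reasoning)

module Conjugation {n : ℕ} (G : FinGroup n) where
  open FinGroup G
  open IsGroup isGroup using (assoc; identityˡ; identityʳ; inverseˡ; inverseʳ)
  open ≡-Reasoning

  φ-homo-∙ : ∀ k x y → φ G k (x ∙ y) ≡ φ G k x ∙ φ G k y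
  φ-homo-∙ k x y = sym (begin
      k ∙ x ∙ k ⁻¹ ∙ (k ∙ y ∙ k ⁻¹)   ≡⟨ assoc (k ∙ x) (k ⁻¹) (k ∙ y ∙ k ⁻¹) ⟩
      k ∙ x ∙ (k ⁻¹ ∙ (k ∙ y ∙ k ⁻¹)) ≡⟨ cong (λ t → k ∙ x ∙ (k ⁻¹ ∙ t)) (assoc k y (k ⁻¹)) ⟩
      k ∙ x ∙ (k ⁻¹ ∙ (k ∙ (y ∙ k ⁻¹))) ≡⟨ cong (k ∙ x ∙_) (sym (assoc (k ⁻¹) k (y ∙ k ⁻¹))) ⟩
      k ∙ x ∙ (k ⁻¹ ∙ k ∙ (y ∙ k ⁻¹)) ≡⟨ cong (λ t → k ∙ x ∙ (t ∙ (y ∙ k ⁻¹))) (inverseˡ k) ⟩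
      k ∙ x ∙ (e ∙ (y ∙ k ⁻¹))         ≡⟨ cong (k ∙ x ∙_) (identityˡ (y ∙ k ⁻¹)) ⟩
      k ∙ x ∙ (y ∙ k ⁻¹)               ≡⟨ sym (assoc (k ∙ x) y (k ⁻¹)) ⟩
      k ∙ x ∙ y ∙ k ⁻¹                 ≡⟨ cong (_∙ k ⁻¹) (assoc k x y) ⟩
      k ∙ (x ∙ y) ∙ k ⁻¹               ∎)

  φ-identity : ∀ k → φ G k e ≡ e
  φ-identity k = trans (cong (_∙ k ⁻¹) (identityʳ k)) (inverseʳ k)

  φ⁻¹-φ : ∀ k y → φ G (k ⁻¹) (φ G k y) ≡ y
  φ⁻¹-φ k y = trans (cong (λ t → φ G (k ⁻¹) (φ G t y)) (sym (GroupProperties.⁻¹-involutive group k)))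
                    (φ-inv G (k ⁻¹) y)

module _ {n : ℕ} (M G : FinGroup n) where
  private
    module M = FinGroup M
    module G = FinGroup G
  open G using (e; _∙_; _⁻¹)
  open Conjugation G

  βOf-at-e : (act : M.Carrier → G.Carrier → G.Carrier) (reg : IsRegular M G act) →
             ∀ h μ → act (βOf M G act reg h μ) e ≡ h ∙ act μ e
  βOf-at-e act reg h μ = proj₂ (IsRegular.transitive reg e (h ∙ act μ e))

  actG-at-e : (α : M.Carrier → Perm G.Carrier) → ∀ g μ → actG M G α g μ e ≡ φ G g (α μ [ e ])
  actG-at-e α g μ = cong (λ x → φ G g (α μ [ x ])) (φ-identity (g ⁻¹))

  βgOf-at-e : (α : M.Carrier → Perm G.Carrier) (reg : IsRegular M G (λ μ → α μ [_])) →
              ∀ g h μ → α (βgOf M G α reg g h μ) [ e ] ≡ φ G (g ⁻¹) h ∙ α μ [ e ]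
  βgOf-at-e α reg g h μ = begin
      α ν [ e ]                             ≡⟨ sym (φ⁻¹-φ g (α ν [ e ])) ⟩
      φ G (g ⁻¹) (φ G g (α ν [ e ]))         ≡⟨ cong (φ G (g ⁻¹)) (sym (actG-at-e α g ν)) ⟩
      φ G (g ⁻¹) (actG M G α g ν e)          ≡⟨ cong (φ G (g ⁻¹)) (βOf-at-e (actG M G α g) (regG M G α reg g) h μ) ⟩
      φ G (g ⁻¹) (h ∙ actG M G α g μ e)      ≡⟨ cong (λ x → φ G (g ⁻¹) (h ∙ x)) (actG-at-e α g μ) ⟩
      φ G (g ⁻¹) (h ∙ φ G g (α μ [ e ]))     ≡⟨ φ-homo-∙ (g ⁻¹) h (φ G g (α μ [ e ])) ⟩
      φ G (g ⁻¹) h ∙ φ G (g ⁻¹) (φ G g (α μ [ e ])) ≡⟨ cong (φ G (g ⁻¹) h ∙_) (φ⁻¹-φ g (α μ [ e ])) ⟩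
      φ G (g ⁻¹) h ∙ α μ [ e ]               ∎
    where
      open ≡-Reasoning
      ν = βgOf M G α reg g h μ

  regular-injective-cancel : (α : M.Carrier → Perm G.Carrier) → IsInjective M G α →
                             IsRegular M G (λ μ → α μ [_]) →
                             ∀ {ν ν′} x → α ν [ x ] ≡ α ν′ [ x ] → ν ≡ ν′
  regular-injective-cancel α inj reg x p = inj _ _ (IsRegular.free reg _ _ x p)

lemma6p1 : (n : ℕ) (G M : FinGroup n)
    (α : FinGroup.Carrier M → Perm (FinGroup.Carrier G))
    → IsHom M G α
    → IsInjective M G α
    → (reg : IsRegular M G (λ μ → α μ [_]))
    → IsGStable M G α
    → ∀ g h μ
    → βgOf M G α reg g h μ ≡ βOf M G (λ μ → α μ [_]) reg (φ G (FinGroup._⁻¹ G g) h) μ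
lemma6p1 n G M α _ inj reg _ g h μ =
  regular-injective-cancel M G α inj reg (FinGroup.e G)
    (trans (βgOf-at-e M G α reg g h μ)
           (sym (βOf-at-e M G (λ ν → α ν [_]) reg (φ G (FinGroup._⁻¹ G g) h) μ)))
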